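{- Let $I$ be a stable matching instance with $n$ boys and $n$ girls and $w:B\times G\to\mathbb{Q}$ a weight function. The set of stable matchings $M$ maximizing $\sum_{bg\in M}w_{bg}$ forms a sublattice of the lattice $\mathcal{L}$ of all stable matchings, i.e., it is closed under the meet and join operations of $\mathcal{L}$.
   Context: A matching is stable if no boy $b$ and girl $g$ not matched together both prefer each other to their partners. For stable matchings $M,M'$: the meet $M\wedge M'$ matches each boy with his more preferred partner among his partners in $M$ and $M'$; the join $M\vee M'$ matches each boy with his less preferred one; both are stable, and the stable matchings form a distributive lattice $\mathcal{L}$ under these operations. -}

module Defs where

open import Data.Nat using (ℕ)
open import Data.Fin using (Fin; _<_; _≤_)
open import Data.Rational using (ℚ; _+_; 0ℚ)
import Data.Rational as Q
open import Data.Product using (_×_; ∃)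
open import Function.Definitions using (Injective)
open import Relation.Binary.PropositionalEquality using (_≡_)
open import Relation.Nullary using (¬_)
open import Relation.Nullary.Decidable using (does)
open import Data.Bool using (if_then_else_)
open import Data.List using (List; foldr; map)
open import Data.List using () renaming (allFin to allFin')
open import Data.Fin using () renaming (_≤?_ to _≤ᶠ?_)

-- Preferences are strict total orders, given by rank functions:
-- rankB b g = position of girl g in boy b's list (smaller = more preferred),
-- rankG g b = position of boy b in girl g's list. Injectivity = strictness.
record Instance (n : ℕ) : Set where
  field
    rankB : Fin n → Fin n → Fin n
    rankG : Fin n → Fin n → Fin n
    rankB-inj : ∀ b → Injective _≡_ _≡_ (rankB b)
    rankG-inj : ∀ g → Injective _≡_ _≡_ (rankG g)

-- A matching assigns to each boy b the girl μ b; it is a perfect matching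
-- when μ is injective (hence a bijection Fin n → Fin n).
Matching : ℕ → Set
Matching n = Fin n → Fin n

IsMatching : ∀ {n} → Matching n → Set
IsMatching μ = Injective _≡_ _≡_ μ

module _ {n : ℕ} (I : Instance n) where
  open Instance I

  BoyPrefers : Fin n → Fin n → Fin n → Set
  BoyPrefers b g g' = rankB b g < rankB b g'

  GirlPrefers : Fin n → Fin n → Fin n → Set
  GirlPrefers g b b' = rankG g b < rankG g b'

  Blocking : Matching n → Fin n → Fin n → Set
  Blocking μ b g = ¬ (μ b ≡ g) × BoyPrefers b g (μ b)
                   × (∀ b' → μ b' ≡ g → GirlPrefers g b b')

  IsStable : Matching n → Set
  IsStable μ = IsMatching μ × (∀ b g → ¬ Blocking μ b g)

  meet : Matching n → Matching n → Matching n
  meet μ ν b = if does (rankB b (μ b) ≤ᶠ? rankB b (ν b)) then μ b else ν b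

  join : Matching n → Matching n → Matching n
  join μ ν b = if does (rankB b (μ b) ≤ᶠ? rankB b (ν b)) then ν b else μ b

weight : ∀ {n} → (Fin n → Fin n → ℚ) → Matching n → ℚ
weight {n} w μ = foldr _+_ 0ℚ (map (λ b → w b (μ b)) (allFin' n))

module _ {n : ℕ} (I : Instance n) (w : Fin n → Fin n → ℚ) where
  IsMaxWeightStable : Matching n → Set
  IsMaxWeightStable μ = IsStable I μ × (∀ ν → IsStable I ν → weight w ν Q.≤ weight w μ)

-- Every boy's partners in μ ∧ ν and μ ∨ ν are his partners in μ and ν, in some
-- order, so weight (μ ∧ ν) + weight (μ ∨ ν) = weight μ + weight ν. Since μ ∧ ν and
-- μ ∨ ν are stable, neither weighs more than the maximum weight μ = weight ν, and
-- hence neither can weigh less.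
module Submission where

open import Defs
open import Data.Nat using (ℕ; zero; suc)
import Data.Nat.Properties as ℕ
open import Data.Fin using (Fin; _≤_; _≤?_; punchOut)
open import Data.Fin.Properties
  using (any?; _≟_; <-cmp; <-irrefl; <-asym; <-trans; ≤-antisym; ≤∧≢⇒<; injective⇒≤; punchOut-injective)
open import Data.Rational using (ℚ; _+_; 0ℚ)
import Data.Rational as ℚ
import Data.Rational.Properties as ℚ
open import Data.Product using (_×_; _,_; ∃; proj₁; proj₂)
open import Data.Sum using (_⊎_; inj₁; inj₂)
open import Data.List using (List; []; _∷_; foldr; map)
open import Data.List using () renaming (allFin to allFin')
open import Data.Empty using (⊥-elim)
open import Relation.Nullary using (¬_; Dec; does; yes; no)
open import Data.Bool using (if_then_else_)
open import Relation.Binary using (tri<; tri≈; tri>)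
open import Relation.Binary.PropositionalEquality
open import Function.Definitions using (Injective)
open import Algebra.Bundles using (CommutativeMonoid)
open import Algebra.Properties.CommutativeSemigroup
  (CommutativeMonoid.commutativeSemigroup ℚ.+-0-commutativeMonoid) using (interchange)

injective⇒surjective : ∀ {n} {f : Fin n → Fin n} → Injective _≡_ _≡_ f → ∀ y → ∃ λ x → f x ≡ y
injective⇒surjective {zero} _ ()
injective⇒surjective {suc m} {f} inj y with any? (λ x → f x ≟ y)
... | yes hit = hit
... | no miss = ⊥-elim (ℕ.<-irrefl refl (injective⇒≤ punchOut∘f-injective))
  where
  y≢f : ∀ x → y ≢ f x
  y≢f x e = miss (x , sym e)
  -- f misses y, so removing y from the codomain injects Fin (suc m) into Fin m
  punchOut∘f-injective : Injective _≡_ _≡_ (λ x → punchOut (y≢f x))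
  punchOut∘f-injective {x} {x'} e = inj (punchOut-injective (y≢f x) (y≢f x') e)

if-does : ∀ {P A : Set} (d : Dec P) {x y : A} →
          ((if does d then x else y) ≡ x × P) ⊎ ((if does d then x else y) ≡ y × ¬ P)
if-does (yes p) = inj₁ (refl , p)
if-does (no ¬p) = inj₂ (refl , ¬p)

module StableLattice {n : ℕ} (I : Instance n) where
  open Instance I

  BoyWeaklyPrefers : Fin n → Fin n → Fin n → Set
  BoyWeaklyPrefers b g g' = rankB b g ≤ rankB b g'

  BoyWeaklyPrefers-antisym : ∀ b {g g'} → BoyWeaklyPrefers b g g' → BoyWeaklyPrefers b g' g → g ≡ g'
  BoyWeaklyPrefers-antisym b le ge = rankB-inj b (≤-antisym le ge)

  BoyWeaklyPrefers⇒≡⊎Prefers : ∀ b {g g'} → BoyWeaklyPrefers b g g' → g ≡ g' ⊎ BoyPrefers I b g g'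
  BoyWeaklyPrefers⇒≡⊎Prefers b {g} {g'} le with g ≟ g'
  ... | yes g≡g' = inj₁ g≡g'
  ... | no g≢g' = inj₂ (≤∧≢⇒< le (λ e → g≢g' (rankB-inj b e)))

  BoyPrefers-irrefl : ∀ b {g} → ¬ BoyPrefers I b g g
  BoyPrefers-irrefl b = <-irrefl refl

  module _ {ν : Matching n} (ν-stable : IsStable I ν) where
    private
      ν-injective : Injective _≡_ _≡_ ν
      ν-injective = proj₁ ν-stable

    stable⇒¬mutuallyPreferred : ∀ {b c g} → ν c ≡ g → GirlPrefers I g b c → ¬ BoyPrefers I b g (ν b)
    stable⇒¬mutuallyPreferred {b} {c} {g} νc≡g g-prefers-b b-prefers-g =
      proj₂ ν-stable b g (νb≢g , b-prefers-g , g-prefers-b-to-partner)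
      where
      νb≢g : ¬ ν b ≡ g
      νb≢g refl = BoyPrefers-irrefl b b-prefers-g
      g-prefers-b-to-partner : ∀ b' → ν b' ≡ g → GirlPrefers I g b b'
      g-prefers-b-to-partner b' νb'≡g with ν-injective (trans νb'≡g (sym νc≡g))
      ... | refl = g-prefers-b

    stable⇒partnerPreferred : ∀ {b c g} → ν c ≡ g → BoyPrefers I b g (ν b) → GirlPrefers I g c b
    stable⇒partnerPreferred {b} {c} {g} νc≡g b-prefers-g with <-cmp (rankG g c) (rankG g b)
    ... | tri< c-first _ _ = c-first
    ... | tri≈ _ same _ with rankG-inj g same
    ...   | refl = ⊥-elim (BoyPrefers-irrefl b (subst (BoyPrefers I b g) νc≡g b-prefers-g))
    stable⇒partnerPreferred νc≡g b-prefers-g | tri> _ _ b-first =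
      ⊥-elim (stable⇒¬mutuallyPreferred νc≡g b-first b-prefers-g)

    stable⇒surjective : ∀ g → ∃ λ c → ν c ≡ g
    stable⇒surjective = injective⇒surjective ν-injective

  Chooses : (Fin n → Fin n → Fin n → Set) → Matching n → Matching n → Matching n → Set
  Chooses R α β m = ∀ b → (m b ≡ α b × R b (α b) (β b)) ⊎ (m b ≡ β b × R b (β b) (α b))

  BoyWeaklyDisprefers : Fin n → Fin n → Fin n → Set
  BoyWeaklyDisprefers b g g' = BoyWeaklyPrefers b g' g

  Chooses-swap : ∀ R {α β m} → Chooses R α β m → Chooses R β α m
  Chooses-swap _ choice b with choice b
  ... | inj₁ αb = inj₂ αb
  ... | inj₂ βb = inj₁ βb

  meet-chooses : ∀ μ ν → Chooses BoyWeaklyPrefers μ ν (meet I μ ν)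
  meet-chooses μ ν b with if-does (rankB b (μ b) ≤? rankB b (ν b)) {μ b} {ν b}
  ... | inj₁ (μb-chosen , μb-first) = inj₁ (μb-chosen , μb-first)
  ... | inj₂ (νb-chosen , μb-not-first) = inj₂ (νb-chosen , ℕ.≰⇒≥ μb-not-first)

  join-chooses : ∀ μ ν → Chooses BoyWeaklyDisprefers μ ν (join I μ ν)
  join-chooses μ ν b with if-does (rankB b (μ b) ≤? rankB b (ν b)) {ν b} {μ b}
  ... | inj₁ (νb-chosen , μb-first) = inj₂ (νb-chosen , μb-first)
  ... | inj₂ (μb-chosen , μb-not-first) = inj₁ (μb-chosen , ℕ.≰⇒≥ μb-not-first)

  Chooses-injective : ∀ R {α β m} → Injective _≡_ _≡_ α → Injective _≡_ _≡_ β →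
                      (∀ {b b'} → α b ≡ β b' → R b (α b) (β b) → R b' (β b') (α b') → b ≡ b') →
                      Chooses R α β m → Injective _≡_ _≡_ m
  Chooses-injective _ α-injective β-injective cross choice {b} {b'} mb≡mb' with choice b | choice b'
  ... | inj₁ (mb≡αb , _) | inj₁ (mb'≡αb' , _) = α-injective (trans (sym mb≡αb) (trans mb≡mb' mb'≡αb'))
  ... | inj₂ (mb≡βb , _) | inj₂ (mb'≡βb' , _) = β-injective (trans (sym mb≡βb) (trans mb≡mb' mb'≡βb'))
  ... | inj₁ (mb≡αb , r) | inj₂ (mb'≡βb' , r') = cross (trans (sym mb≡αb) (trans mb≡mb' mb'≡βb')) r r'
  ... | inj₂ (mb≡βb , r) | inj₁ (mb'≡αb' , r') =
    sym (cross (trans (sym mb'≡αb') (trans (sym mb≡mb') mb≡βb)) r' r)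

  meet-preferred⇒preferred : ∀ {α β m b g} → Chooses BoyWeaklyPrefers α β m →
                             BoyPrefers I b g (m b) → BoyPrefers I b g (α b)
  meet-preferred⇒preferred {b = b} {g} choice g-first with choice b
  ... | inj₁ (mb≡αb , _) = subst (BoyPrefers I b g) mb≡αb g-first
  ... | inj₂ (mb≡βb , βb-first) = ℕ.<-≤-trans (subst (BoyPrefers I b g) mb≡βb g-first) βb-first

  join-rejected⇒otherPartnerPreferred : ∀ {α β j d e g} → IsStable I β →
                                        Chooses BoyWeaklyDisprefers α β j →
                                        α d ≡ g → β e ≡ g → j d ≢ g → GirlPrefers I g e d
  join-rejected⇒otherPartnerPreferred {β = β} {d = d} β-stable choice αd≡g βe≡g jd≢g with choice d
  ... | inj₁ (jd≡αd , _) = ⊥-elim (jd≢g (trans jd≡αd αd≡g))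
  ... | inj₂ (jd≡βd , αd-first) with BoyWeaklyPrefers⇒≡⊎Prefers d αd-first
  ...   | inj₁ αd≡βd = ⊥-elim (jd≢g (trans jd≡βd (trans (sym αd≡βd) αd≡g)))
  ...   | inj₂ d-prefers =
    stable⇒partnerPreferred β-stable βe≡g (subst (λ x → BoyPrefers I d x (β d)) αd≡g d-prefers)

  -- Stability of β makes g prefer her β-partner c to b, so the join rejects c; she
  -- then prefers her α-partner d to c, so the join rejects d too, and then she
  -- prefers c to d.
  join-unblocked : ∀ {α β j b g} → IsStable I α → IsStable I β → Chooses BoyWeaklyDisprefers α β j →
                   BoyPrefers I b g (β b) → ¬ (∀ b' → j b' ≡ g → GirlPrefers I g b b')
  join-unblocked {j = j} {b} {g} α-stable β-stable choice g-first g-prefers-b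
    with stable⇒surjective β-stable g | stable⇒surjective α-stable g
  ... | c , βc≡g | d , αd≡g = <-asym c-over-d d-over-c
    where
    unmatched : ∀ {x} → GirlPrefers I g x b → j x ≢ g
    unmatched x-over-b jx≡g = <-asym x-over-b (g-prefers-b _ jx≡g)
    c-over-b : GirlPrefers I g c b
    c-over-b = stable⇒partnerPreferred β-stable βc≡g g-first
    d-over-c : GirlPrefers I g d c
    d-over-c = join-rejected⇒otherPartnerPreferred α-stable (Chooses-swap BoyWeaklyDisprefers choice)
                 βc≡g αd≡g (unmatched c-over-b)
    c-over-d : GirlPrefers I g c d
    c-over-d = join-rejected⇒otherPartnerPreferred β-stable choice
                 αd≡g βc≡g (unmatched (<-trans d-over-c c-over-b))

  module _ {α β : Matching n} (α-stable : IsStable I α) (β-stable : IsStable I β) where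
    private
      α-injective : Injective _≡_ _≡_ α
      α-injective = proj₁ α-stable
      β-injective : Injective _≡_ _≡_ β
      β-injective = proj₁ β-stable

    meet-cross : ∀ {b b'} → α b ≡ β b' →
                 BoyWeaklyPrefers b (α b) (β b) → BoyWeaklyPrefers b' (β b') (α b') → b ≡ b'
    meet-cross {b} {b'} αb≡βb' αb-first βb'-first
      with BoyWeaklyPrefers⇒≡⊎Prefers b αb-first | BoyWeaklyPrefers⇒≡⊎Prefers b' βb'-first
    ... | inj₁ αb≡βb | _ = β-injective (trans (sym αb≡βb) αb≡βb')
    ... | inj₂ _ | inj₁ βb'≡αb' = α-injective (trans αb≡βb' βb'≡αb')
    ... | inj₂ b-prefers | inj₂ b'-prefers = ⊥-elim (<-asym b-over-b' b'-over-b)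
      where
      b-over-b' : GirlPrefers I (β b') b b'
      b-over-b' = stable⇒partnerPreferred α-stable αb≡βb' b'-prefers
      b'-over-b : GirlPrefers I (β b') b' b
      b'-over-b = subst (λ g → GirlPrefers I g b' b) αb≡βb'
                    (stable⇒partnerPreferred β-stable (sym αb≡βb') b-prefers)

    meet-stable : IsStable I (meet I α β)
    meet-stable = m-injective , m-unblocked
      where
      m : Matching n
      m = meet I α β
      choice : Chooses BoyWeaklyPrefers α β m
      choice = meet-chooses α β
      m-injective : Injective _≡_ _≡_ m
      m-injective = Chooses-injective BoyWeaklyPrefers α-injective β-injective meet-cross choice
      m-unblocked : ∀ b g → ¬ Blocking I m b g
      m-unblocked b g (_ , g-first , g-prefers-b) with injective⇒surjective m-injective g
      ... | c , mc≡g with choice c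
      ...   | inj₁ (mc≡αc , _) = stable⇒¬mutuallyPreferred α-stable (trans (sym mc≡αc) mc≡g)
                                   (g-prefers-b c mc≡g) (meet-preferred⇒preferred choice g-first)
      ...   | inj₂ (mc≡βc , _) = stable⇒¬mutuallyPreferred β-stable (trans (sym mc≡βc) mc≡g)
                                   (g-prefers-b c mc≡g)
                                   (meet-preferred⇒preferred (Chooses-swap BoyWeaklyPrefers choice) g-first)

    -- The meet, a bijection, matches α b ≡ β b' to some boy c; c is b or b', and the
    -- two preference inequalities force c to have the same partner in α and β.
    join-cross : ∀ {b b'} → α b ≡ β b' →
                 BoyWeaklyDisprefers b (α b) (β b) → BoyWeaklyDisprefers b' (β b') (α b') → b ≡ b'
    join-cross {b} {b'} αb≡βb' βb-first αb'-first with injective⇒surjective (proj₁ meet-stable) (α b)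
    ... | c , mc≡αb with meet-chooses α β c
    ...   | inj₁ (mc≡αc , αc-first) with α-injective (trans (sym mc≡αc) mc≡αb)
    ...     | refl = β-injective (trans (sym (BoyWeaklyPrefers-antisym b αc-first βb-first)) αb≡βb')
    join-cross {b} {b'} αb≡βb' βb-first αb'-first | c , mc≡αb | inj₂ (mc≡βc , βc-first)
      with β-injective (trans (sym mc≡βc) (trans mc≡αb αb≡βb'))
    ...     | refl = α-injective (trans αb≡βb' (BoyWeaklyPrefers-antisym b' βc-first αb'-first))

    join-stable : IsStable I (join I α β)
    join-stable = Chooses-injective BoyWeaklyDisprefers α-injective β-injective join-cross choice , j-unblocked
      where
      choice : Chooses BoyWeaklyDisprefers α β (join I α β)
      choice = join-chooses α β
      j-unblocked : ∀ b g → ¬ Blocking I (join I α β) b g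
      j-unblocked b g (_ , g-first , g-prefers-b) with choice b
      ... | inj₁ (jb≡αb , _) = join-unblocked β-stable α-stable (Chooses-swap BoyWeaklyDisprefers choice)
                                 (subst (BoyPrefers I b g) jb≡αb g-first) g-prefers-b
      ... | inj₂ (jb≡βb , _) = join-unblocked α-stable β-stable choice
                                 (subst (BoyPrefers I b g) jb≡βb g-first) g-prefers-b

sumMap : ∀ {A : Set} → (A → ℚ) → List A → ℚ
sumMap f xs = foldr _+_ 0ℚ (map f xs)

sumMap-+-cong : ∀ {A : Set} (f g f' g' : A → ℚ) → (∀ x → f x + g x ≡ f' x + g' x) →
                ∀ xs → sumMap f xs + sumMap g xs ≡ sumMap f' xs + sumMap g' xs
sumMap-+-cong f g f' g' pointwise [] = refl
sumMap-+-cong f g f' g' pointwise (x ∷ xs) = begin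
  (f x + sumMap f xs) + (g x + sumMap g xs)     ≡⟨ interchange (f x) (sumMap f xs) (g x) (sumMap g xs) ⟩
  (f x + g x) + (sumMap f xs + sumMap g xs)     ≡⟨ cong₂ _+_ (pointwise x) (sumMap-+-cong f g f' g' pointwise xs) ⟩
  (f' x + g' x) + (sumMap f' xs + sumMap g' xs) ≡⟨ interchange (f' x) (g' x) (sumMap f' xs) (sumMap g' xs) ⟩
  (f' x + sumMap f' xs) + (g' x + sumMap g' xs) ∎
  where open ≡-Reasoning

if-swap-+ : ∀ {P A : Set} (d : Dec P) (f : A → ℚ) x y →
            f (if does d then x else y) + f (if does d then y else x) ≡ f x + f y
if-swap-+ (yes _) f x y = refl
if-swap-+ (no _) f x y = ℚ.+-comm (f y) (f x)

meet+join-weight : ∀ {n} (I : Instance n) (w : Fin n → Fin n → ℚ) μ ν →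
                   weight w (meet I μ ν) + weight w (join I μ ν) ≡ weight w μ + weight w ν
meet+join-weight {n} I w μ ν = sumMap-+-cong _ _ _ _ swapped (allFin' n)
  where
  open Instance I
  swapped : ∀ b → w b (meet I μ ν b) + w b (join I μ ν b) ≡ w b (μ b) + w b (ν b)
  swapped b = if-swap-+ (rankB b (μ b) ≤? rankB b (ν b)) (w b) (μ b) (ν b)

+≡+⇒≤⇒≥ : ∀ {p q r s : ℚ} → p + q ≡ r + s → q ℚ.≤ s → r ℚ.≤ p
+≡+⇒≤⇒≥ {p} {q} {r} {s} p+q≡r+s q≤s with r ℚ.≤? p
... | yes r≤p = r≤p
... | no r≰p = ⊥-elim (ℚ.<-irrefl p+q≡r+s (ℚ.+-mono-<-≤ (ℚ.≰⇒> r≰p) q≤s))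

balanced⇒maxWeight : ∀ {n} (I : Instance n) (w : Fin n → Fin n → ℚ) {μ ν ρ σ : Matching n} →
                     IsMaxWeightStable I w μ → IsMaxWeightStable I w ν → IsStable I ρ → IsStable I σ →
                     weight w ρ + weight w σ ≡ weight w μ + weight w ν →
                     IsMaxWeightStable I w ρ × IsMaxWeightStable I w σ
balanced⇒maxWeight I w {μ} {ν} {ρ} {σ} (_ , μ-max) (_ , ν-max) ρ-stable σ-stable balance =
    (ρ-stable , λ τ τ-stable → ℚ.≤-trans (μ-max τ τ-stable) μ≤ρ)
  , (σ-stable , λ τ τ-stable → ℚ.≤-trans (ν-max τ τ-stable) ν≤σ)
  where
  μ≤ρ : weight w μ ℚ.≤ weight w ρ
  μ≤ρ = +≡+⇒≤⇒≥ balance (ν-max σ σ-stable)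
  ν≤σ : weight w ν ℚ.≤ weight w σ
  ν≤σ = +≡+⇒≤⇒≥ {q = weight w ρ} (begin
          weight w σ + weight w ρ ≡⟨ ℚ.+-comm (weight w σ) (weight w ρ) ⟩
          weight w ρ + weight w σ ≡⟨ balance ⟩
          weight w μ + weight w ν ≡⟨ ℚ.+-comm (weight w μ) (weight w ν) ⟩
          weight w ν + weight w μ ∎)
        (μ-max ρ ρ-stable)
    where open ≡-Reasoning

theorem5 : (n : ℕ) (I : Instance n) (w : Fin n → Fin n → ℚ) (μ ν : Matching n) →
           IsMaxWeightStable I w μ → IsMaxWeightStable I w ν →
           IsMaxWeightStable I w (meet I μ ν) × IsMaxWeightStable I w (join I μ ν)
theorem5 n I w μ ν μ-max@(μ-stable , _) ν-max@(ν-stable , _) =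
  balanced⇒maxWeight I w μ-max ν-max (meet-stable μ-stable ν-stable) (join-stable μ-stable ν-stable)
                     (meet+join-weight I w μ ν)
  where open StableLattice I
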